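{- For all $n\ge3$, $|\mathrm{Av}^\star_{3n}(123)|=0$. Also $|\mathrm{Av}^\star_3(123)|=2$ and $|\mathrm{Av}^\star_6(123)|=6$.
   Context: Permutations are written in one-line notation; a permutation avoids $\sigma$ if no subsequence is in the same relative order as $\sigma$. $\mathcal{S}^\star_{3n}$ is the set of permutations of $[3n]=\{1,\dots,3n\}$ whose cycle decomposition consists only of 3-cycles, and $\mathrm{Av}^\star_{3n}(123)$ the set of those avoiding 123. -}

module Defs where

open import Data.Nat using (ℕ; zero; suc; _*_)
open import Data.Fin using (Fin; _<_)
open import Data.Vec using (Vec; lookup)
open import Data.List using (List; length)
open import Data.List.Membership.Propositional using (_∈_)
open import Data.List.Relation.Unary.Unique.Propositional using (Unique)
open import Data.Product using (Σ; ∃; _×_; _,_)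
open import Relation.Binary.PropositionalEquality using (_≡_; _≢_)
open import Relation.Nullary using (¬_)
open import Function.Bundles using (_⇔_)

-- A word of length m over [m] in one-line notation: position i ↦ lookup w i.
-- (Fin m plays the role of [m] = {1,…,m}, shifted down by one.)
Word : ℕ → Set
Word m = Vec (Fin m) m

app : ∀ {m} → Word m → Fin m → Fin m
app w i = lookup w i

iter : ∀ {m} → ℕ → Word m → Fin m → Fin m
iter zero    w i = i
iter (suc k) w i = app w (iter k w i)

-- w is a permutation of [m] (injective self-map of a finite set)
IsPerm : ∀ {m} → Word m → Set
IsPerm w = ∀ i j → app w i ≡ app w j → i ≡ j

OnlyThreeCycles : ∀ {m} → Word m → Set
OnlyThreeCycles w = ∀ i → iter 1 w i ≢ i × iter 2 w i ≢ i × iter 3 w i ≡ i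

Contains123 : ∀ {m} → Word m → Set
Contains123 w = ∃ λ i → ∃ λ j → ∃ λ k →
  (i < j) × (j < k) × (app w i < app w j) × (app w j < app w k)

Avoids123 : ∀ {m} → Word m → Set
Avoids123 w = ¬ Contains123 w

InAvStar123 : ∀ {m} → Word m → Set
InAvStar123 w = IsPerm w × OnlyThreeCycles w × Avoids123 w

HasCard : ∀ {m} → (Word m → Set) → ℕ → Set
HasCard {m} P c = Σ (List (Word m)) λ ws →
  Unique ws × (∀ w → (w ∈ ws) ⇔ P w) × (length ws ≡ c)

-- Every σ ∈ Av*_{k+3}(123) is obtained from some τ ∈ Av*_k(123) by inserting a 3-cycle (0 P Q)
-- through the first point: conversely, deleting the cycle of 0 from σ and standardising the remaining
-- points along the order embedding  skip : [k] → [k+3] ∖ {0, P, Q}  keeps σ a permutation with only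
-- 3-cycles, and any 123 in the result would be a 123 in σ. Hence Av*_{k+3}(123) lies in the finite list
-- of insertions into Av*_k(123); filtering these lists by a decision procedure gives Av*_3(123) and
-- Av*_6(123) explicitly and shows Av*_9(123) = ∅, after which Av*_{3n}(123) = ∅ for all n ≥ 3 by induction.
module Submission where

open import Defs
open import Data.Nat using (ℕ; zero; suc; s≤s; _+_; _∸_; _*_; _≤_)
open import Data.Nat.Properties using (*-suc; m+[n∸m]≡n; <⇒≤)
open import Data.Fin using (Fin; zero; suc; _<_; punchIn; _≟_; _<?_; #_)
open import Data.Fin.Properties
  using (suc-injective; punchIn-injective; punchInᵢ≢i; punchIn-mono-≤; <⇒≢; ≤∧≢⇒<; all?; any?)
open import Data.Vec using ([]; _∷_; tabulate)
open import Data.Vec.Properties using (lookup∘tabulate; tabulate∘lookup; tabulate-cong; ≡-dec)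
open import Data.List using (List; []; _∷_; allFin; length; cartesianProduct; cartesianProductWith)
open import Data.List.Membership.Propositional using (_∈_)
open import Data.List.Membership.Propositional.Properties
  using (∈-allFin; ∈-cartesianProduct⁺; ∈-cartesianProductWith⁺)
import Data.List.Membership.DecPropositional as DecMembership
open import Data.List.Relation.Unary.All as All using (All)
open import Data.List.Relation.Unary.AllPairs using (allPairs?)
open import Data.List.Relation.Unary.Any using (here)
open import Data.List.Relation.Unary.Unique.Propositional using (Unique)
open import Data.Product using (∃; ∃₂; _×_; _,_; proj₁; proj₂)
open import Data.Empty using (⊥-elim)
open import Function using (_∘_)
open import Function.Bundles using (mk⇔)
open import Function.Definitions using (Injective)
open import Relation.Binary.Definitions using (Monotonic₁)
open import Relation.Binary.PropositionalEquality using (_≡_; _≢_; refl; sym; trans; cong; subst; subst₂)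
open Relation.Binary.PropositionalEquality.≡-Reasoning
open import Relation.Nullary using (¬_; Dec; ¬?)
open import Relation.Nullary.Decidable using (True; _×-dec_; _→-dec_; toWitness)

punchIn-mono-< : ∀ {n} (x : Fin (suc n)) → Monotonic₁ _<_ _<_ (punchIn x)
punchIn-mono-< x {i} {j} i<j =
  ≤∧≢⇒< (punchIn-mono-≤ x i j (<⇒≤ i<j)) (<⇒≢ i<j ∘ punchIn-injective x i j)

data PunchInView {n} (x : Fin (suc n)) : Fin (suc n) → Set where
  is-pivot   : PunchInView x x
  punchIn-of : ∀ i → PunchInView x (punchIn x i)

punchInView : ∀ {n} (x j : Fin (suc n)) → PunchInView x j
punchInView zero    zero    = is-pivot
punchInView zero    (suc j) = punchIn-of j
punchInView {suc _} (suc x) zero = punchIn-of zero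
punchInView {suc _} (suc x) (suc j) with punchInView x j
... | is-pivot     = is-pivot
... | punchIn-of i = punchIn-of (suc i)

module _ {k m} (e : Fin k → Fin m) {σ : Word m} {τ : Word k}
         (intertwine : ∀ i → e (app τ i) ≡ app σ (e i)) where

  iter-intertwine : ∀ n i → e (iter n τ i) ≡ iter n σ (e i)
  iter-intertwine zero    i = refl
  iter-intertwine (suc n) i = trans (intertwine (iter n τ i)) (cong (app σ) (iter-intertwine n i))

  isPerm-restrict : Injective _≡_ _≡_ e → IsPerm σ → IsPerm τ
  isPerm-restrict e-inj σ-perm i j τi≡τj =
    e-inj (σ-perm (e i) (e j) (trans (sym (intertwine i)) (trans (cong e τi≡τj) (intertwine j))))

  onlyThreeCycles-restrict : Injective _≡_ _≡_ e → OnlyThreeCycles σ → OnlyThreeCycles τ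
  onlyThreeCycles-restrict e-inj σ-three i with σ-three (e i)
  ... | σ¹≢ , σ²≢ , σ³≡ =
      (λ eq → σ¹≢ (trans (sym (iter-intertwine 1 i)) (cong e eq)))
    , (λ eq → σ²≢ (trans (sym (iter-intertwine 2 i)) (cong e eq)))
    , e-inj (trans (iter-intertwine 3 i) σ³≡)

  avoids123-restrict : Monotonic₁ _<_ _<_ e → Avoids123 σ → Avoids123 τ
  avoids123-restrict e-mono σ-avoids (i , j , l , i<j , j<l , τi<τj , τj<τl) =
    σ-avoids (e i , e j , e l , e-mono i<j , e-mono j<l
             , subst₂ _<_ (intertwine i) (intertwine j) (e-mono τi<τj)
             , subst₂ _<_ (intertwine j) (intertwine l) (e-mono τj<τl))

  inAvStar123-restrict : Injective _≡_ _≡_ e → Monotonic₁ _<_ _<_ e → InAvStar123 σ → InAvStar123 τ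
  inAvStar123-restrict e-inj e-mono (σ-perm , σ-three , σ-avoids) =
    isPerm-restrict e-inj σ-perm , onlyThreeCycles-restrict e-inj σ-three , avoids123-restrict e-mono σ-avoids

-- The 3-cycle (0 P Q) is parametrised by P = 1 + p and Q = 1 + punchIn p q, so that P ≢ Q by construction.
module ThreeCycleThroughZero {k} (p : Fin (2 + k)) (q : Fin (1 + k)) where

  P Q : Fin (3 + k)
  P = suc p
  Q = suc (punchIn p q)

  skip : Fin k → Fin (3 + k)
  skip i = suc (punchIn p (punchIn q i))

  skip-injective : Injective _≡_ _≡_ skip
  skip-injective = punchIn-injective q _ _ ∘ punchIn-injective p _ _ ∘ suc-injective

  skip-mono-< : Monotonic₁ _<_ _<_ skip
  skip-mono-< = s≤s ∘ punchIn-mono-< p ∘ punchIn-mono-< q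

  skip≢0 : ∀ i → skip i ≢ zero
  skip≢0 i ()

  skip≢P : ∀ i → skip i ≢ P
  skip≢P i = punchInᵢ≢i p _ ∘ suc-injective

  skip≢Q : ∀ i → skip i ≢ Q
  skip≢Q i = punchInᵢ≢i q i ∘ punchIn-injective p _ _ ∘ suc-injective

  data Position : Fin (3 + k) → Set where
    at-0    : Position zero
    at-P    : Position P
    at-Q    : Position Q
    at-skip : ∀ i → Position (skip i)

  position : ∀ j → Position j
  position zero = at-0
  position (suc j) with punchInView p j
  ... | is-pivot = at-P
  ... | punchIn-of i with punchInView q i
  ...   | is-pivot      = at-Q
  ...   | punchIn-of i′ = at-skip i′

  unskip : ∀ {j} → Position j → j ≢ zero → j ≢ P → j ≢ Q → Fin k
  unskip at-0        j≢0 _   _   = ⊥-elim (j≢0 refl)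
  unskip at-P        _   j≢P _   = ⊥-elim (j≢P refl)
  unskip at-Q        _   _   j≢Q = ⊥-elim (j≢Q refl)
  unskip (at-skip i) _   _   _   = i

  skip-unskip : ∀ {j} (v : Position j) j≢0 j≢P j≢Q → skip (unskip v j≢0 j≢P j≢Q) ≡ j
  skip-unskip at-0        j≢0 _   _   = ⊥-elim (j≢0 refl)
  skip-unskip at-P        _   j≢P _   = ⊥-elim (j≢P refl)
  skip-unskip at-Q        _   _   j≢Q = ⊥-elim (j≢Q refl)
  skip-unskip (at-skip i) _   _   _   = refl

  insertCycleAt : Word k → ∀ {j} → Position j → Fin (3 + k)
  insertCycleAt τ at-0        = P
  insertCycleAt τ at-P        = Q
  insertCycleAt τ at-Q        = zero
  insertCycleAt τ (at-skip i) = skip (app τ i)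

  insertCycle : Word k → Word (3 + k)
  insertCycle τ = tabulate (insertCycleAt τ ∘ position)

  module Restriction (σ : Word (3 + k)) (σ-perm : IsPerm σ)
                     (σ0≡P : app σ zero ≡ P) (σP≡Q : app σ P ≡ Q) (σQ≡0 : app σ Q ≡ zero) where

    σskip≢0 : ∀ i → app σ (skip i) ≢ zero
    σskip≢0 i eq = skip≢Q i (σ-perm (skip i) Q (trans eq (sym σQ≡0)))
    σskip≢P : ∀ i → app σ (skip i) ≢ P
    σskip≢P i eq = skip≢0 i (σ-perm (skip i) zero (trans eq (sym σ0≡P)))
    σskip≢Q : ∀ i → app σ (skip i) ≢ Q
    σskip≢Q i eq = skip≢P i (σ-perm (skip i) P (trans eq (sym σP≡Q)))

    restriction : Word k
    restriction = tabulate λ i → unskip (position (app σ (skip i))) (σskip≢0 i) (σskip≢P i) (σskip≢Q i)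

    skip-restriction : ∀ i → skip (app restriction i) ≡ app σ (skip i)
    skip-restriction i = trans (cong skip (lookup∘tabulate _ i))
      (skip-unskip (position (app σ (skip i))) (σskip≢0 i) (σskip≢P i) (σskip≢Q i))

    insertCycle-restriction : σ ≡ insertCycle restriction
    insertCycle-restriction = trans (sym (tabulate∘lookup σ)) (tabulate-cong (agree ∘ position))
      where
        agree : ∀ {j} (v : Position j) → app σ j ≡ insertCycleAt restriction v
        agree at-0        = σ0≡P
        agree at-P        = σP≡Q
        agree at-Q        = σQ≡0
        agree (at-skip i) = sym (skip-restriction i)

open ThreeCycleThroughZero using (insertCycle)

deleteCycleOfZero : ∀ {k} (σ : Word (3 + k)) → InAvStar123 σ →
                    ∃₂ λ p q → ∃ λ τ → InAvStar123 τ × σ ≡ insertCycle p q τ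
deleteCycleOfZero σ σ∈@(σ-perm , σ-three , _) with app σ zero in σ0≡
... | zero = ⊥-elim (proj₁ (σ-three zero) σ0≡)
... | suc p with app σ (suc p) in σP≡
...   | zero = ⊥-elim (proj₁ (proj₂ (σ-three zero)) (trans (cong (app σ) σ0≡) σP≡))
...   | suc q′ with punchInView p q′
...     | is-pivot     = ⊥-elim (proj₁ (σ-three (suc p)) σP≡)
...     | punchIn-of q = p , q , restriction , τ∈ , insertCycle-restriction
  where
    open ThreeCycleThroughZero p q
    σQ≡0 : app σ Q ≡ zero
    σQ≡0 = begin
      app σ Q                ≡⟨ cong (app σ) (sym σP≡) ⟩
      app σ (app σ (suc p))  ≡⟨ cong (app σ ∘ app σ) (sym σ0≡) ⟩
      iter 3 σ zero          ≡⟨ proj₂ (proj₂ (σ-three zero)) ⟩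
      zero                   ∎
    open Restriction σ σ-perm σ0≡ σP≡ σQ≡0
    τ∈ : InAvStar123 restriction
    τ∈ = inAvStar123-restrict skip {σ} {restriction} skip-restriction skip-injective skip-mono-< σ∈

Covers : ∀ {m} → List (Word m) → Set
Covers ws = ∀ w → InAvStar123 w → w ∈ ws

candidates : ∀ {k} → List (Word k) → List (Word (3 + k))
candidates = cartesianProductWith (λ (p , q) → insertCycle p q) (cartesianProduct (allFin _) (allFin _))

candidates-covers : ∀ {k} {τs : List (Word k)} → Covers τs → Covers (candidates τs)
candidates-covers τs-cover σ σ∈ with deleteCycleOfZero σ σ∈
... | p , q , τ , τ∈ , refl =
  ∈-cartesianProductWith⁺ _ (∈-cartesianProduct⁺ (∈-allFin p) (∈-allFin q)) (τs-cover τ τ∈)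

NoAvStar123 : ℕ → Set
NoAvStar123 m = (σ : Word m) → ¬ InAvStar123 σ

noAvStar123-step : ∀ {k} → NoAvStar123 k → NoAvStar123 (3 + k)
noAvStar123-step none σ σ∈ with deleteCycleOfZero σ σ∈
... | _ , _ , τ , τ∈ , _ = none τ τ∈

inAvStar123? : ∀ {m} (w : Word m) → Dec (InAvStar123 w)
inAvStar123? w =
        all? (λ i → all? (λ j → (app w i ≟ app w j) →-dec (i ≟ j)))
  ×-dec all? (λ i → ¬? (iter 1 w i ≟ i) ×-dec ¬? (iter 2 w i ≟ i) ×-dec (iter 3 w i ≟ i))
  ×-dec ¬? (any? λ i → any? λ j → any? λ l →
          (i <? j) ×-dec (j <? l) ×-dec (app w i <? app w j) ×-dec (app w j <? app w l))

_∈?_ : ∀ {m} (w : Word m) (ws : List (Word m)) → Dec (w ∈ ws)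
_∈?_ = DecMembership._∈?_ (≡-dec _≟_)

covers-from-candidates : ∀ {k} {τs : List (Word k)} (ws : List (Word (3 + k))) → Covers τs →
                         All (λ c → InAvStar123 c → c ∈ ws) (candidates τs) → Covers ws
covers-from-candidates ws τs-cover filtered σ σ∈ =
  All.lookup filtered (candidates-covers τs-cover σ σ∈) σ∈

avStar123-0 : List (Word 0)
avStar123-0 = [] ∷ []

avStar123-3 : List (Word 3)
avStar123-3 = (# 1 ∷ # 2 ∷ # 0 ∷ []) ∷ (# 2 ∷ # 0 ∷ # 1 ∷ []) ∷ []

avStar123-6 : List (Word 6)
avStar123-6 = (# 2 ∷ # 5 ∷ # 4 ∷ # 1 ∷ # 0 ∷ # 3 ∷ [])
            ∷ (# 3 ∷ # 2 ∷ # 5 ∷ # 4 ∷ # 0 ∷ # 1 ∷ [])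
            ∷ (# 3 ∷ # 5 ∷ # 1 ∷ # 4 ∷ # 0 ∷ # 2 ∷ [])
            ∷ (# 4 ∷ # 2 ∷ # 5 ∷ # 0 ∷ # 3 ∷ # 1 ∷ [])
            ∷ (# 4 ∷ # 3 ∷ # 0 ∷ # 5 ∷ # 2 ∷ # 1 ∷ [])
            ∷ (# 4 ∷ # 5 ∷ # 1 ∷ # 0 ∷ # 3 ∷ # 2 ∷ [])
            ∷ []

covers-0 : Covers avStar123-0
covers-0 [] _ = here refl

covers-3 : Covers avStar123-3
covers-3 = covers-from-candidates avStar123-3 covers-0
  (toWitness {a? = All.all? (λ c → inAvStar123? c →-dec (c ∈? avStar123-3)) (candidates avStar123-0)} _)

covers-6 : Covers avStar123-6
covers-6 = covers-from-candidates avStar123-6 covers-3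
  (toWitness {a? = All.all? (λ c → inAvStar123? c →-dec (c ∈? avStar123-6)) (candidates avStar123-3)} _)

covers-nothing : ∀ {m} → Covers {m} [] → NoAvStar123 m
covers-nothing cover σ σ∈ with () ← cover σ σ∈

noAvStar123-9 : NoAvStar123 9
noAvStar123-9 = covers-nothing (covers-from-candidates [] covers-6
  (toWitness {a? = All.all? (λ c → inAvStar123? c →-dec (c ∈? [])) (candidates avStar123-6)} _))

noAvStar123-3* : ∀ n → 3 ≤ n → NoAvStar123 (3 * n)
noAvStar123-3* n 3≤n = subst (NoAvStar123 ∘ (3 *_)) (m+[n∸m]≡n 3≤n) (noAvStar123-3*[3+] (n ∸ 3))
  where
    noAvStar123-3*[3+] : ∀ j → NoAvStar123 (3 * (3 + j))
    noAvStar123-3*[3+] zero    = noAvStar123-9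
    noAvStar123-3*[3+] (suc j) =
      subst NoAvStar123 (sym (*-suc 3 (3 + j))) (noAvStar123-step (noAvStar123-3*[3+] j))

unique? : ∀ {m} (ws : List (Word m)) → Dec (Unique ws)
unique? = allPairs? (λ x y → ¬? (≡-dec _≟_ x y))

hasCard-ofCovering : ∀ {m} (ws : List (Word m)) → Covers ws →
                     {_ : True (unique? ws)} {_ : True (All.all? inAvStar123? ws)} →
                     HasCard (InAvStar123 {m}) (length ws)
hasCard-ofCovering ws complete {unique} {sound} =
  ws , toWitness unique , (λ w → mk⇔ (All.lookup (toWitness sound)) (complete w)) , refl

theorem5p1 : ((n : ℕ) → 3 ≤ n → HasCard (InAvStar123 {3 * n}) 0)
    × HasCard (InAvStar123 {3 * 1}) 2
    × HasCard (InAvStar123 {3 * 2}) 6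
theorem5p1 =
    (λ n 3≤n → hasCard-ofCovering [] λ σ σ∈ → ⊥-elim (noAvStar123-3* n 3≤n σ σ∈))
  , hasCard-ofCovering avStar123-3 covers-3
  , hasCard-ofCovering avStar123-6 covers-6
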